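{- Let $G$ be a connected graph of order $n$. Then $\mathrm{fxd}(G)=n-1$ if and only if there exist distinct vertices $u,v\in V(G)$ with $N(v)\setminus\{u\}=N(u)\setminus\{v\}$.
   Context: Graphs are finite and simple and (standing assumption) have nontrivial automorphism group $\mathrm{Aut}(G)$. $N(v)$ is the set of neighbours of $v$. For $S\subseteq V(G)$, $\mathrm{stab}(S)=\{g\in \mathrm{Aut}(G): g(v)=v \text{ for all } v\in S\}$; $S$ is a fixing set if $\mathrm{stab}(S)$ is trivial. $\mathrm{fxd}(G)$ is the minimum $k$ such that every $k$-element subset of $V(G)$ is a fixing set of $G$. -}

module Defs where

open import Data.Nat using (ℕ; _≤_)
open import Data.Fin using (Fin)
open import Data.Fin.Subset using (Subset; _∈_; ∣_∣)
open import Data.Fin.Permutation using (Permutation′; _⟨$⟩ʳ_)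
open import Data.Bool using (Bool; true; false)
open import Data.Product using (Σ; ∃; _×_)
open import Relation.Binary.PropositionalEquality using (_≡_; _≢_)

record Graph (n : ℕ) : Set where
  field
    adj   : Fin n → Fin n → Bool
    sym   : ∀ u v → adj u v ≡ adj v u
    irrefl : ∀ v → adj v v ≡ false
open Graph public

module _ {n : ℕ} (G : Graph n) where

  Adj : Fin n → Fin n → Set
  Adj u v = adj G u v ≡ true

  data Walk : Fin n → Fin n → Set where
    here : ∀ {u} → Walk u u
    step : ∀ {u w v} → Adj u w → Walk w v → Walk u v

  Connected : Set
  Connected = ∀ u v → Walk u v

  IsAutomorphism : Permutation′ n → Set
  IsAutomorphism g = ∀ u v → adj G (g ⟨$⟩ʳ u) (g ⟨$⟩ʳ v) ≡ adj G u v

  NontrivialAut : Set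
  NontrivialAut = Σ (Permutation′ n) λ g → IsAutomorphism g × ∃ λ v → g ⟨$⟩ʳ v ≢ v

  InStab : Subset n → Permutation′ n → Set
  InStab S g = ∀ v → v ∈ S → g ⟨$⟩ʳ v ≡ v

  FixingSet : Subset n → Set
  FixingSet S = ∀ g → IsAutomorphism g → InStab S g → ∀ v → g ⟨$⟩ʳ v ≡ v

  AllFixing : ℕ → Set
  AllFixing k = ∀ (S : Subset n) → ∣ S ∣ ≡ k → FixingSet S

  FxdIs : ℕ → Set
  FxdIs k = AllFixing k × (∀ j → AllFixing j → k ≤ j)

-- If u and v are twins, the transposition (u v) is an automorphism fixing every set that
-- avoids u and v, so no set of at most n − 2 vertices is forced to be fixing; on the other
-- hand every set of n − 1 vertices is fixing, because an automorphism fixing S pointwise and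
-- moving x also moves g x, and both lie outside S. Conversely, if there are no twins then
-- every set S of n − 2 vertices is fixing: an automorphism fixing S and moving x fixes every
-- vertex other than x and g x, which makes x and g x twins. As Aut(G) is nontrivial, n ≥ 2
-- and so n − 2 < n − 1.
module Submission where

open import Defs
open import Data.Nat using (ℕ; zero; suc; _+_; _∸_; _≤_; _<_; z≤n; s≤s)
open import Data.Nat.Properties
  using (≤-trans; ≤-reflexive; <⇒≱; ≮⇒≥; <⇒≤pred; 1+n≰n; n≤1+n; +-comm; +-suc; +-monoʳ-≤;
         ∸-monoʳ-≤; ∸-monoʳ-<; pred[m∸n]≡m∸[1+n]; m≤n+m∸n; m≤n+o⇒m∸n≤o; module ≤-Reasoning)
open import Data.Fin using (Fin; _≟_)
open import Data.Fin.Properties using (any?; all?)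
open import Data.Fin.Subset using (Subset; inside; outside; _∈_; _∉_; _⊆_; ⊥; ⁅_⁆; _∪_; ∁; ∣_∣)
open import Data.Fin.Subset.Properties
  using (_∈?_; ∣⊥∣≡0; ∣⊤∣≡n; ∣⁅x⁆∣≡1; ∣∁p∣≡n∸∣p∣; ⊆-min; out⊆; in⊆in; ∈⊤; x∈p∪q⁺;
         x∈∁p⇒x∉p; x∉p⇒x∈∁p; x∉⁅y⁆⇒x≢y; x∈p∧x≢y⇒x∈p-y; x∈p⇒∣p-x∣<∣p∣)
open import Data.Vec using (_∷_; [])
open import Data.Bool using (true; false)
import Data.Bool as Bool
open import Data.Product using (Σ; ∃; ∃₂; _×_; _,_; proj₁; proj₂)
open import Data.Sum using (inj₁; inj₂)
open import Function using (_∘_)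
open import Function.Bundles using (_⇔_; mk⇔; Injection; Equivalence)
open import Function.Properties.Inverse using (↔⇒↣)
open import Relation.Nullary using (Dec; yes; no; ¬_; contradiction)
open import Relation.Nullary.Decidable using (_×-dec_; _→-dec_; ¬?)
open import Relation.Binary.PropositionalEquality
  using (_≡_; _≢_; refl; trans; cong; cong₂; subst; module ≡-Reasoning)
import Relation.Binary.PropositionalEquality as ≡
open import Data.Fin.Permutation using (Permutation′; _⟨$⟩ʳ_; transpose)
import Data.Fin.Permutation.Components as PC

m∸[m∸n]≤n : ∀ m n → m ∸ (m ∸ n) ≤ n
m∸[m∸n]≤n m n = m≤n+o⇒m∸n≤o m (m ∸ n) (subst (m ≤_) (+-comm n (m ∸ n)) (m≤n+m∸n m n))

∣p∪q∣≤∣p∣+∣q∣ : ∀ {n} (p q : Subset n) → ∣ p ∪ q ∣ ≤ ∣ p ∣ + ∣ q ∣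
∣p∪q∣≤∣p∣+∣q∣ []            []            = z≤n
∣p∪q∣≤∣p∣+∣q∣ (outside ∷ p) (outside ∷ q) = ∣p∪q∣≤∣p∣+∣q∣ p q
∣p∪q∣≤∣p∣+∣q∣ (outside ∷ p) (inside  ∷ q) =
  ≤-trans (s≤s (∣p∪q∣≤∣p∣+∣q∣ p q)) (≤-reflexive (≡.sym (+-suc ∣ p ∣ ∣ q ∣)))
∣p∪q∣≤∣p∣+∣q∣ (inside  ∷ p) (outside ∷ q) = s≤s (∣p∪q∣≤∣p∣+∣q∣ p q)
∣p∪q∣≤∣p∣+∣q∣ (inside  ∷ p) (inside  ∷ q) =
  s≤s (≤-trans (∣p∪q∣≤∣p∣+∣q∣ p q) (+-monoʳ-≤ ∣ p ∣ (n≤1+n ∣ q ∣)))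

∃⊆-of-size : ∀ {n} (p : Subset n) j → j ≤ ∣ p ∣ → ∃ λ q → q ⊆ p × ∣ q ∣ ≡ j
∃⊆-of-size {n} p zero _ = ⊥ , ⊆-min p , ∣⊥∣≡0 n
∃⊆-of-size (outside ∷ p) (suc j) j<∣p∣ with ∃⊆-of-size p (suc j) j<∣p∣
... | q , q⊆p , ∣q∣≡1+j = outside ∷ q , out⊆ q⊆p , ∣q∣≡1+j
∃⊆-of-size (inside ∷ p) (suc j) (s≤s j≤∣p∣) with ∃⊆-of-size p j j≤∣p∣
... | q , q⊆p , ∣q∣≡j = inside ∷ q , in⊆in q⊆p , cong suc ∣q∣≡j

x∈p⇒1≤∣p∣ : ∀ {n x} {p : Subset n} → x ∈ p → 1 ≤ ∣ p ∣
x∈p⇒1≤∣p∣ x∈p = ≤-trans (s≤s z≤n) (x∈p⇒∣p-x∣<∣p∣ x∈p)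

x,y∈p⇒2≤∣p∣ : ∀ {n x y} {p : Subset n} → x ∈ p → y ∈ p → x ≢ y → 2 ≤ ∣ p ∣
x,y∈p⇒2≤∣p∣ x∈p y∈p x≢y =
  ≤-trans (s≤s (x∈p⇒1≤∣p∣ (x∈p∧x≢y⇒x∈p-y y∈p (x≢y ∘ ≡.sym)))) (x∈p⇒∣p-x∣<∣p∣ x∈p)

x,y,z∈p⇒3≤∣p∣ : ∀ {n x y z} {p : Subset n} → x ∈ p → y ∈ p → z ∈ p →
                x ≢ y → x ≢ z → y ≢ z → 3 ≤ ∣ p ∣
x,y,z∈p⇒3≤∣p∣ x∈p y∈p z∈p x≢y x≢z y≢z =
  ≤-trans (s≤s (x,y∈p⇒2≤∣p∣ (x∈p∧x≢y⇒x∈p-y y∈p (x≢y ∘ ≡.sym))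
                            (x∈p∧x≢y⇒x∈p-y z∈p (x≢z ∘ ≡.sym)) y≢z))
          (x∈p⇒∣p-x∣<∣p∣ x∈p)

∣p∣≡n∸k⇒∣∁p∣≤k : ∀ {n k} (p : Subset n) → ∣ p ∣ ≡ n ∸ k → ∣ ∁ p ∣ ≤ k
∣p∣≡n∸k⇒∣∁p∣≤k {n} {k} p ∣p∣≡n∸k = ≤-trans
  (≤-reflexive (trans (∣∁p∣≡n∸∣p∣ p) (cong (n ∸_) ∣p∣≡n∸k))) (m∸[m∸n]≤n n k)

∃-avoiding : ∀ {n j} (u v : Fin n) → j ≤ n ∸ 2 → ∃ λ S → ∣ S ∣ ≡ j × (∀ {x} → x ∈ S → x ≢ u × x ≢ v)
∃-avoiding {n} {j} u v j≤n∸2 with ∃⊆-of-size (∁ (⁅ u ⁆ ∪ ⁅ v ⁆)) j j≤∣∁⁅u⁆∪⁅v⁆∣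
  where
  j≤∣∁⁅u⁆∪⁅v⁆∣ : j ≤ ∣ ∁ (⁅ u ⁆ ∪ ⁅ v ⁆) ∣
  j≤∣∁⁅u⁆∪⁅v⁆∣ = begin
    j                       ≤⟨ j≤n∸2 ⟩
    n ∸ 2                   ≤⟨ ∸-monoʳ-≤ n (≤-trans (∣p∪q∣≤∣p∣+∣q∣ ⁅ u ⁆ ⁅ v ⁆)
                                 (≤-reflexive (cong₂ _+_ (∣⁅x⁆∣≡1 u) (∣⁅x⁆∣≡1 v)))) ⟩
    n ∸ ∣ ⁅ u ⁆ ∪ ⁅ v ⁆ ∣   ≡⟨ ∣∁p∣≡n∸∣p∣ (⁅ u ⁆ ∪ ⁅ v ⁆) ⟨
    ∣ ∁ (⁅ u ⁆ ∪ ⁅ v ⁆) ∣   ∎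
    where open ≤-Reasoning
... | S , S⊆∁⁅u⁆∪⁅v⁆ , ∣S∣≡j = S , ∣S∣≡j , λ x∈S →
  let x∉⁅u⁆∪⁅v⁆ = x∈∁p⇒x∉p (S⊆∁⁅u⁆∪⁅v⁆ x∈S)
  in x∉⁅y⁆⇒x≢y (x∉⁅u⁆∪⁅v⁆ ∘ x∈p∪q⁺ ∘ inj₁) , x∉⁅y⁆⇒x≢y (x∉⁅u⁆∪⁅v⁆ ∘ x∈p∪q⁺ ∘ inj₂)

data Transposed {n} (u v : Fin n) : Fin n → Fin n → Set where
  u↦v : Transposed u v u v
  v↦u : Transposed u v v u
  fixed : ∀ {x} → x ≢ u → x ≢ v → Transposed u v x x

transposed : ∀ {n} {u v : Fin n} → u ≢ v → ∀ x → Transposed u v x (PC.transpose u v x)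
transposed {u = u} {v} u≢v x with x ≟ u
... | yes refl = u↦v
... | no x≢u with x ≟ v
...   | yes refl = v↦u
...   | no x≢v = fixed x≢u x≢v

module _ {n} {u v : Fin n} where

  transposed-first : ∀ {y} → Transposed u v u y → y ≡ v
  transposed-first u↦v = refl
  transposed-first v↦u = refl
  transposed-first (fixed u≢u _) = contradiction refl u≢u

  transposed-other : ∀ {x y} → Transposed u v x y → x ≢ u → x ≢ v → y ≡ x
  transposed-other u↦v x≢u _ = contradiction refl x≢u
  transposed-other v↦u _ x≢v = contradiction refl x≢v
  transposed-other (fixed _ _) _ _ = refl

module _ {n : ℕ} (G : Graph n) where

  Twins : Fin n → Fin n → Set
  Twins u v = ∀ w → w ≢ u → w ≢ v → adj G u w ≡ adj G v w

  HasTwins : Set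
  HasTwins = ∃₂ λ u v → u ≢ v × Twins u v

  ¬Adj-refl : ∀ v → ¬ Adj G v v
  ¬Adj-refl v vv with trans (≡.sym vv) (irrefl G v)
  ... | ()

  twins⇔sameNeighbourhoods : ∀ {u v} → Twins u v ⇔ (∀ w → (Adj G v w × w ≢ u) ⇔ (Adj G u w × w ≢ v))
  twins⇔sameNeighbourhoods {u} {v} = mk⇔ (λ twins w → mk⇔ (to twins w) (from twins w)) agree
    where
    to : Twins u v → ∀ w → Adj G v w × w ≢ u → Adj G u w × w ≢ v
    to twins w (vw , w≢u) with w ≟ v
    ... | yes refl = contradiction vw (¬Adj-refl w)
    ... | no w≢v = trans (twins w w≢u w≢v) vw , w≢v
    from : Twins u v → ∀ w → Adj G u w × w ≢ v → Adj G v w × w ≢ u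
    from twins w (uw , w≢v) with w ≟ u
    ... | yes refl = contradiction uw (¬Adj-refl w)
    ... | no w≢u = trans (≡.sym (twins w w≢u w≢v)) uw , w≢u
    agree : (∀ w → (Adj G v w × w ≢ u) ⇔ (Adj G u w × w ≢ v)) → Twins u v
    agree same w w≢u w≢v with adj G u w in uw | adj G v w in vw
    ... | true  | true  = refl
    ... | false | false = refl
    ... | true  | false =
      contradiction (trans (≡.sym vw) (proj₁ (Equivalence.from (same w) (uw , w≢v)))) λ ()
    ... | false | true  =
      contradiction (trans (≡.sym uw) (proj₁ (Equivalence.to (same w) (vw , w≢u)))) λ ()

  hasTwins? : Dec HasTwins
  hasTwins? = any? λ u → any? λ v → ¬? (u ≟ v) ×-dec
    all? λ w → ¬? (w ≟ u) →-dec ¬? (w ≟ v) →-dec adj G u w Bool.≟ adj G v w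

  transpose-isAutomorphism : ∀ {u v} → u ≢ v → Twins u v → IsAutomorphism G (transpose u v)
  transpose-isAutomorphism {u} {v} u≢v agree x y = preserves (transposed u≢v x) (transposed u≢v y)
    where
    preserves : ∀ {x x′ y y′} → Transposed u v x x′ → Transposed u v y y′ → adj G x′ y′ ≡ adj G x y
    preserves u↦v u↦v = trans (irrefl G v) (≡.sym (irrefl G u))
    preserves u↦v v↦u = sym G v u
    preserves u↦v (fixed y≢u y≢v) = ≡.sym (agree _ y≢u y≢v)
    preserves v↦u u↦v = sym G u v
    preserves v↦u v↦u = trans (irrefl G u) (≡.sym (irrefl G v))
    preserves v↦u (fixed y≢u y≢v) = agree _ y≢u y≢v
    preserves (fixed x≢u x≢v) u↦v = trans (sym G _ v) (trans (≡.sym (agree _ x≢u x≢v)) (sym G u _))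
    preserves (fixed x≢u x≢v) v↦u = trans (sym G _ u) (trans (agree _ x≢u x≢v) (sym G v _))
    preserves (fixed _ _) (fixed _ _) = refl

  module _ {S : Subset n} (g : Permutation′ n) (fix : InStab G S g)
           {x : Fin n} (gx≢x : g ⟨$⟩ʳ x ≢ x) where

    moved⇒∉ : x ∉ S
    moved⇒∉ x∈S = gx≢x (fix x x∈S)

    moved⇒image∉ : g ⟨$⟩ʳ x ∉ S
    moved⇒image∉ gx∈S = gx≢x (Injection.injective (↔⇒↣ g) (fix (g ⟨$⟩ʳ x) gx∈S))

  allFixing-n∸1 : AllFixing G (n ∸ 1)
  allFixing-n∸1 S ∣S∣≡n∸1 g _ fix x with g ⟨$⟩ʳ x ≟ x
  ... | yes gx≡x = gx≡x
  ... | no gx≢x = contradiction (≤-trans 2≤∣∁S∣ (∣p∣≡n∸k⇒∣∁p∣≤k S ∣S∣≡n∸1)) (1+n≰n {1})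
    where
    2≤∣∁S∣ : 2 ≤ ∣ ∁ S ∣
    2≤∣∁S∣ = x,y∈p⇒2≤∣p∣ (x∉p⇒x∈∁p (moved⇒∉ g fix gx≢x)) (x∉p⇒x∈∁p (moved⇒image∉ g fix gx≢x))
                         (gx≢x ∘ ≡.sym)

  twins⇒¬allFixing : ∀ {u v j} → u ≢ v → Twins u v → j ≤ n ∸ 2 → ¬ AllFixing G j
  twins⇒¬allFixing {u} {v} {j} u≢v agree j≤n∸2 allFixing with ∃-avoiding u v j≤n∸2
  ... | S , ∣S∣≡j , avoids = u≢v (trans (≡.sym τu≡u) (transposed-first (transposed u≢v u)))
    where
    fix : InStab G S (transpose u v)
    fix x x∈S = transposed-other (transposed u≢v x) (proj₁ (avoids x∈S)) (proj₂ (avoids x∈S))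
    τu≡u : transpose u v ⟨$⟩ʳ u ≡ u
    τu≡u = allFixing S ∣S∣≡j (transpose u v) (transpose-isAutomorphism u≢v agree) fix u

  fixesOthers⇒twins : ∀ g {x} → IsAutomorphism G g →
    (∀ y → y ≢ x → y ≢ g ⟨$⟩ʳ x → g ⟨$⟩ʳ y ≡ y) → Twins x (g ⟨$⟩ʳ x)
  fixesOthers⇒twins g {x} aut fixesOthers y y≢x y≢gx = begin
    adj G x y                         ≡⟨ aut x y ⟨
    adj G (g ⟨$⟩ʳ x) (g ⟨$⟩ʳ y)       ≡⟨ cong (adj G (g ⟨$⟩ʳ x)) (fixesOthers y y≢x y≢gx) ⟩
    adj G (g ⟨$⟩ʳ x) y                ∎
    where open ≡-Reasoning

  ¬twins⇒allFixing-n∸2 : ¬ HasTwins → AllFixing G (n ∸ 2)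
  ¬twins⇒allFixing-n∸2 noTwins S ∣S∣≡n∸2 g aut fix x with g ⟨$⟩ʳ x ≟ x
  ... | yes gx≡x = gx≡x
  ... | no gx≢x =
    contradiction (x , g ⟨$⟩ʳ x , gx≢x ∘ ≡.sym , fixesOthers⇒twins g aut fixesOthers) noTwins
    where
    fixesOthers : ∀ y → y ≢ x → y ≢ g ⟨$⟩ʳ x → g ⟨$⟩ʳ y ≡ y
    fixesOthers y y≢x y≢gx with y ∈? S
    ... | yes y∈S = fix y y∈S
    ... | no y∉S = contradiction (≤-trans 3≤∣∁S∣ (∣p∣≡n∸k⇒∣∁p∣≤k S ∣S∣≡n∸2)) (1+n≰n {2})
      where
      3≤∣∁S∣ : 3 ≤ ∣ ∁ S ∣
      3≤∣∁S∣ = x,y,z∈p⇒3≤∣p∣ (x∉p⇒x∈∁p (moved⇒∉ g fix gx≢x)) (x∉p⇒x∈∁p (moved⇒image∉ g fix gx≢x))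
                             (x∉p⇒x∈∁p y∉S) (gx≢x ∘ ≡.sym) (y≢x ∘ ≡.sym) (y≢gx ∘ ≡.sym)

  twins⇒fxd≡n∸1 : ∀ {u v} → u ≢ v → Twins u v → FxdIs G (n ∸ 1)
  twins⇒fxd≡n∸1 u≢v agree = allFixing-n∸1 , λ j allFixing → ≮⇒≥ λ j<n∸1 →
    twins⇒¬allFixing u≢v agree (subst (j ≤_) (pred[m∸n]≡m∸[1+n] n 1) (<⇒≤pred j<n∸1)) allFixing

  fxd≡n∸1⇒twins : NontrivialAut G → FxdIs G (n ∸ 1) → HasTwins
  fxd≡n∸1⇒twins (g , _ , x , gx≢x) (_ , minimal) with hasTwins?
  ... | yes twins = twins
  ... | no noTwins = contradiction (minimal (n ∸ 2) (¬twins⇒allFixing-n∸2 noTwins)) (<⇒≱ n∸2<n∸1)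
    where
    2≤n : 2 ≤ n
    2≤n = subst (2 ≤_) (∣⊤∣≡n n) (x,y∈p⇒2≤∣p∣ ∈⊤ ∈⊤ gx≢x)
    n∸2<n∸1 : n ∸ 2 < n ∸ 1
    n∸2<n∸1 = ∸-monoʳ-< (s≤s (s≤s z≤n)) 2≤n

theorem2 : (n : ℕ) (G : Graph n) → NontrivialAut G → Connected G →
    FxdIs G (n ∸ 1) ⇔
    (Σ (Fin n) λ u → Σ (Fin n) λ v → u ≢ v ×
    (∀ w → (adj G v w ≡ true × w ≢ u) ⇔ (adj G u w ≡ true × w ≢ v)))
theorem2 n G nontrivial _ = mk⇔
  (λ fxd → let u , v , u≢v , twins = fxd≡n∸1⇒twins G nontrivial fxd
           in u , v , u≢v , Equivalence.to (twins⇔sameNeighbourhoods G) twins)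
  (λ (u , v , u≢v , same) →
     twins⇒fxd≡n∸1 G u≢v (Equivalence.from (twins⇔sameNeighbourhoods G) same))
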